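{- Let $K$ be a simplicial complex on $[m]$ whose Taylor resolution is minimal. Then $\mathrm{Tor}^{*,*}_{\Bbbk[m]}(\Bbbk[K],\Bbbk)$ is described as follows: it has a $\Bbbk$-basis consisting of the elements $W_\sigma$ for $\sigma\subseteq N(K)$; the multidegree of $W_\sigma$, $\sigma=\{J_1,\dots,J_\ell\}$, is $\bigl(-\ell,\,2\bigcup_{i=1}^\ell J_i\bigr)\in\mathbb{Z}\times\mathbb{Z}^m$; and the multiplication is given by $W_\sigma\cdot W_\tau=\mathrm{sgn}(\sigma,\tau)W_{\sigma\sqcup\tau}$ if $\sigma\cap\tau=\varnothing$ and $\bigl(\bigcup_{J\in\sigma}J\bigr)\cap\bigl(\bigcup_{I\in\tau}I\bigr)=\varnothing$, and $W_\sigma\cdot W_\tau=0$ otherwise.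
   Context: $\Bbbk$ is a field, $\Bbbk[m]=\Bbbk[v_1,\dots,v_m]$, multigraded by $\mathrm{mdeg}(v_1^{n_1}\cdots v_m^{n_m})=(2n_1,\dots,2n_m)$; a subset $B\subseteq[m]$ is identified with its indicator vector in $\mathbb{Z}^m$, and $v^B=\prod_{i\in B}v_i$; $\Bbbk[m]^+=(v_1,\dots,v_m)$. A simplicial complex on $[m]$ is a collection of subsets closed under taking subsets and containing $\varnothing$; $\Bbbk[K]=\Bbbk[m]/(v^I: I\notin K)$. $N(K)$ is the set of minimal non-simplices (subsets not in $K$ all of whose proper subsets are in $K$), with a fixed linear order. The Taylor resolution $\mathcal{R}_T=\bigoplus_\ell R_T^{ -\ell}$: $R_T^{ -\ell}$ is the free $\Bbbk[m]$-module with basis $W_\sigma=w_{J_1}\wedge\dots\wedge w_{J_\ell}$, $\sigma=\{J_1<\dots<J_\ell\}\subseteq N(K)$, of multidegree $(-\ell,2\bigcup J_i)$; differential $d_T(W_\sigma)=\sum_{i=1}^\ell(-1)^{i+1}v^{X_{\sigma,J_i}}W_{\sigma\setminus\{J_i\}}$ with $X_{\sigma,J_i}=J_i\setminus\bigcup_{k\neq i}J_k$; product $W_\sigma\cdot W_\tau=0$ if $\sigma\cap\tau\neq\varnothing$ and $W_\sigma\cdot W_\tau=\mathrm{sgn}(\sigma,\tau)v^{Y_{\sigma,\tau}}W_{\sigma\sqcup\tau}$ otherwise, where $Y_{\sigma,\tau}=(\bigcup_{J\in\sigma}J)\cap(\bigcup_{I\in\tau}I)$ and $\mathrm{sgn}(\sigma,\tau)$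 is the sign of the permutation sorting the sequence $(J_1,\dots,J_\ell,I_1,\dots,I_k)$ (elements of $\sigma$ then of $\tau$, each in increasing order). This is a free multiplicative resolution of $\Bbbk[K]$, and $\mathrm{Tor}^{*,*}_{\Bbbk[m]}(\Bbbk[K],\Bbbk)$ is identified with $H^*(\mathcal{R}_T\otimes_{\Bbbk[m]}\Bbbk)$, with multigrading and multiplication induced from $\mathcal{R}_T$ (this multiplication coincides with the standard $\mathrm{Tor}$-algebra structure). The Taylor resolution is minimal if $\operatorname{im}(d_T)\subseteq\Bbbk[m]^+\cdot\mathcal{R}_T$. The elements $W_\sigma$ in the claim denote the classes of $W_\sigma\otimes1$. -}

module Defs where

open import Level using (Level; _⊔_) renaming (suc to lsuc)
open import Algebra.Bundles using (CommutativeRing)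
open import Data.Nat as ℕ using (ℕ; zero; suc)
open import Data.Integer as ℤ using (ℤ)
open import Data.Fin using (Fin; zero; suc)
open import Data.Fin.Subset hiding (_-_)
import Data.Fin.Subset as Sub
open import Data.Vec.Properties using (≡-dec)
import Data.Bool.Properties as BoolP
open import Data.Bool using (Bool; true; false; if_then_else_; not; _∧_)
open import Data.Vec using (Vec; []; _∷_; map; lookup)
open import Data.Product using (Σ; ∃; _×_; _,_)
open import Relation.Nullary using (¬_; ⌊_⌋)
open import Relation.Binary.PropositionalEquality using (_≡_)
open import Function.Bundles using (_⇔_)

record Field c ℓ : Set (lsuc (c ⊔ ℓ)) where
  field
    commutativeRing : CommutativeRing c ℓ
  open CommutativeRing commutativeRing public
  field
    1≉0     : ¬ (1# ≈ 0#)
    inverse : ∀ x → ¬ (x ≈ 0#) → ∃ λ y → x * y ≈ 1#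

record SimplicialComplex (m : ℕ) : Set₁ where
  field
    IsFace  : Subset m → Set
    ∅-face  : IsFace ⊥
    closed  : ∀ {A B} → A ⊆ B → IsFace B → IsFace A

IsMinNonFace : ∀ {m} → SimplicialComplex m → Subset m → Set
IsMinNonFace K A = ¬ IsFace A × (∀ B → B ⊂ A → IsFace B)
  where open SimplicialComplex K

-- N(K) with a fixed linear order: an injective enumeration
-- J : Fin n → Subset m whose image is exactly N(K); the order on N(K)
-- is J 0 < J 1 < ... < J (n-1).
record NonFaceEnumeration {m} (K : SimplicialComplex m) (n : ℕ) : Set₁ where
  field
    J         : Fin n → Subset m
    injective : ∀ i j → J i ≡ J j → i ≡ j
    exactly   : ∀ A → IsMinNonFace K A ⇔ (∃ λ i → J i ≡ A)

-- Combinatorial helpers.  A subset σ ⊆ N(K) is a 'Subset n'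
-- (σ ∋ i means J i ∈ σ).

⋃J : ∀ {n m} → (Fin n → Subset m) → Subset n → Subset m
⋃J {zero}  J []            = ⊥
⋃J {suc n} J (false ∷ σ)   = ⋃J (λ i → J (suc i)) σ
⋃J {suc n} J (true  ∷ σ)   = J zero ∪ ⋃J (λ i → J (suc i)) σ

_⊖_ : ∀ {n} → Subset n → Fin n → Subset n
p ⊖ i = p Sub.- i

isEmptyB : ∀ {m} → Subset m → Bool
isEmptyB []      = true
isEmptyB (b ∷ p) = not b ∧ isEmptyB p

below : ∀ {n} → Fin n → Subset n
below zero    = ⊥
below (suc i) = true ∷ below i

sumFinℕ : ∀ {n} → (Fin n → ℕ) → ℕ
sumFinℕ {zero}  f = 0
sumFinℕ {suc n} f = f zero ℕ.+ sumFinℕ (λ i → f (suc i))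

-- number of inversions of the sequence (σ in increasing order, then
-- τ in increasing order): #{(a , b) | a ∈ σ, b ∈ τ, b < a}
inversions : ∀ {n} → Subset n → Subset n → ℕ
inversions σ τ = sumFinℕ (λ a → if lookup σ a then ∣ τ ∩ below a ∣ else 0)

-- The complex R_T ⊗_{k[m]} k and its multiplication, for a field F and
-- an ordered list J of the minimal non-faces.

module TaylorTor {c ℓ} (F : Field c ℓ) {m n : ℕ} (J : Fin n → Subset m) where
  open Field F hiding (zero)

  _≟S_ : ∀ {k} (p q : Subset k) → _
  _≟S_ = ≡-dec BoolP._≟_

  sign : ℕ → Carrier
  sign zero    = 1#
  sign (suc k) = - sign k

  sumFin : ∀ {k} → (Fin k → Carrier) → Carrier
  sumFin {zero}  f = 0#
  sumFin {suc k} f = f zero + sumFin (λ i → f (suc i))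

  sumAll : ∀ {k} → (Subset k → Carrier) → Carrier
  sumAll {zero}  f = f []
  sumAll {suc k} f = sumAll (λ p → f (false ∷ p)) + sumAll (λ p → f (true ∷ p))

  -- the augmentation k[m] → k (v_i ↦ 0) applied to the monomial v^X
  augMonomial : Subset m → Carrier
  augMonomial X = if isEmptyB X then 1# else 0#

  X : Subset n → Fin n → Subset m
  X σ i = J i ─ ⋃J J (σ ⊖ i)

  Y : Subset n → Subset n → Subset m
  Y σ τ = ⋃J J σ ∩ ⋃J J τ

  sgn : Subset n → Subset n → Carrier
  sgn σ τ = sign (inversions σ τ)

  -- elements of R_T ⊗ k: k-linear combinations of the W_σ
  Chain : Set c
  Chain = Subset n → Carrier

  0C : Chain
  0C ρ = 0#

  _•_ : Carrier → Chain → Chain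
  (a • z) ρ = a * z ρ

  W : Subset n → Chain
  W σ ρ = if ⌊ ρ ≟S σ ⌋ then 1# else 0#

  lincomb : (Subset n → Carrier) → Chain
  lincomb c ρ = sumAll (λ σ → c σ * W σ ρ)

  mdeg : Subset n → ℤ × Vec ℕ m
  mdeg σ = (ℤ.- (ℤ.+ ∣ σ ∣) , map (λ b → if b then 2 else 0) (⋃J J σ))

  -- (d_T ⊗ 1)(W_σ ⊗ 1) = Σ_{i ∈ σ} (-1)^{pos(i)+1} ε(v^{X_{σ,J_i}}) W_{σ \ J_i}
  -- where pos(i)+1 ≡ #{ j ∈ σ | j < i } mod 2
  dW : Subset n → Chain
  dW σ = λ ρ → sumFin (λ i →
    if lookup σ i
    then sign ∣ σ ∩ below i ∣ * augMonomial (X σ i) * W (σ ⊖ i) ρ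
    else 0#)

  D : Chain → Chain
  D z ρ = sumAll (λ σ → z σ * dW σ ρ)

  mulW : Subset n → Subset n → Chain
  mulW σ τ = if isEmptyB (σ ∩ τ)
             then (sgn σ τ * augMonomial (Y σ τ)) • W (σ ∪ τ)
             else 0C

  _·_ : Chain → Chain → Chain
  (a · b) ρ = sumAll (λ σ → sumAll (λ τ → (a σ * b τ) * mulW σ τ ρ))

  -- cohomology H(R_T ⊗ k) = Tor(k[K], k): cocycles modulo coboundaries
  IsCocycle : Chain → Set ℓ
  IsCocycle z = ∀ ρ → D z ρ ≈ 0#

  _∼_ : Chain → Chain → Set (c ⊔ ℓ)
  z ∼ z' = ∃ λ w → ∀ ρ → D w ρ ≈ z ρ - z' ρ

-- Minimality of the Taylor resolution: im(d_T) ⊆ k[m]^+ · R_T.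
-- Since d_T(W_σ) = Σ ± v^{X_{σ,J_i}} W_{σ\J_i} with distinct basis
-- elements, this says every coefficient monomial v^{X_{σ,J_i}} lies in
-- k[m]^+ = (v_1,…,v_m), i.e. is a non-constant monomial.

MonomialInMaxIdeal : ∀ {m} → Subset m → Set
MonomialInMaxIdeal X = Nonempty X

TaylorMinimal : ∀ {m n} → (Fin n → Subset m) → Set
TaylorMinimal {m} {n} J =
  ∀ (σ : Subset n) (i : Fin n) → i ∈ σ → MonomialInMaxIdeal (J i ─ ⋃J J (σ ⊖ i))

-- Minimality says that every coefficient v^{X_{σ,J_i}} of d_T lies in the
-- maximal ideal, so the augmentation kills it and R_T ⊗ k has zero
-- differential.  Hence Tor = H(R_T ⊗ k) is R_T ⊗ k itself: the W_σ are
-- cocycles, no nonzero combination of them is a coboundary, every chain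
-- is the combination of its own coordinates, and the product is the
-- augmented Taylor product, in which v^{Y_{σ,τ}} survives exactly when
-- Y_{σ,τ} = ∅.
module Submission where

open import Defs
open import Data.Nat using (ℕ; zero; suc)
open import Data.Integer as ℤ using (ℤ)
open import Data.Fin using (Fin; zero; suc)
open import Data.Fin.Subset using (Subset; Nonempty; ∣_∣; _∩_; _∪_)
open import Data.Bool using (true; false; not; if_then_else_; _∧_)
open import Data.Bool.Properties using (∧-zeroʳ)
open import Data.Vec using ([]; _∷_; map; lookup; here; there)
open import Data.Vec.Properties using (lookup⇒[]=)
open import Data.Product using (∃; _×_; _,_)
open import Data.Empty using (⊥-elim)
open import Relation.Nullary using (¬_; yes; no)
open import Relation.Binary.PropositionalEquality using (_≡_; refl; sym)

Nonempty⇒isEmptyB≡false : ∀ {k} {p : Subset k} → Nonempty p → isEmptyB p ≡ false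
Nonempty⇒isEmptyB≡false {p = true ∷ p} (zero , here) = refl
Nonempty⇒isEmptyB≡false {p = b ∷ p} (suc x , there x∈p)
  rewrite Nonempty⇒isEmptyB≡false (x , x∈p) = ∧-zeroʳ (not b)

module TaylorTorProperties {c ℓ} (F : Field c ℓ) {m n : ℕ} (J : Fin n → Subset m) where
  open Field F hiding (zero) renaming (refl to ≈-refl; sym to ≈-sym; trans to ≈-trans)
  open TaylorTor F J
  open import Algebra.Properties.Ring ring using (-0#≈0#)
  open import Relation.Binary.Reasoning.Setoid setoid

  sumFin-≈0 : ∀ {k} (f : Fin k → Carrier) → (∀ i → f i ≈ 0#) → sumFin f ≈ 0#
  sumFin-≈0 {zero}  f f≈0 = ≈-refl
  sumFin-≈0 {suc k} f f≈0 =
    ≈-trans (+-cong (f≈0 zero) (sumFin-≈0 _ (λ i → f≈0 (suc i)))) (+-identityˡ 0#)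

  sumAll-≈0 : ∀ {k} (f : Subset k → Carrier) → (∀ p → f p ≈ 0#) → sumAll f ≈ 0#
  sumAll-≈0 {zero}  f f≈0 = f≈0 []
  sumAll-≈0 {suc k} f f≈0 =
    ≈-trans (+-cong (sumAll-≈0 _ (λ p → f≈0 (false ∷ p))) (sumAll-≈0 _ (λ p → f≈0 (true ∷ p))))
            (+-identityˡ 0#)

  sumAll-point : ∀ {k} (f : Subset k → Carrier) (ρ : Subset k) →
                 (∀ p → ¬ p ≡ ρ → f p ≈ 0#) → sumAll f ≈ f ρ
  sumAll-point f []          f≈0 = ≈-refl
  sumAll-point f (false ∷ ρ) f≈0 =
    ≈-trans (+-cong (sumAll-point _ ρ (λ p p≢ρ → f≈0 (false ∷ p) λ { refl → p≢ρ refl }))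
                    (sumAll-≈0 _ (λ p → f≈0 (true ∷ p) λ ())))
            (+-identityʳ _)
  sumAll-point f (true ∷ ρ)  f≈0 =
    ≈-trans (+-cong (sumAll-≈0 _ (λ p → f≈0 (false ∷ p) λ ()))
                    (sumAll-point _ ρ (λ p p≢ρ → f≈0 (true ∷ p) λ { refl → p≢ρ refl })))
            (+-identityˡ _)

  W-diag : ∀ σ → W σ σ ≈ 1#
  W-diag σ with σ ≟S σ
  ... | yes _   = ≈-refl
  ... | no σ≢σ = ⊥-elim (σ≢σ refl)

  W-offdiag : ∀ σ ρ → ¬ ρ ≡ σ → W σ ρ ≈ 0#
  W-offdiag σ ρ ρ≢σ with ρ ≟S σ
  ... | yes ρ≡σ = ⊥-elim (ρ≢σ ρ≡σ)
  ... | no _    = ≈-refl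

  lincomb-coordinate : ∀ a ρ → lincomb a ρ ≈ a ρ
  lincomb-coordinate a ρ = begin
    sumAll (λ σ → a σ * W σ ρ) ≈⟨ sumAll-point _ ρ off-ρ ⟩
    a ρ * W ρ ρ                ≈⟨ *-congˡ (W-diag ρ) ⟩
    a ρ * 1#                   ≈⟨ *-identityʳ _ ⟩
    a ρ                        ∎
    where
    off-ρ : ∀ σ → ¬ σ ≡ ρ → a σ * W σ ρ ≈ 0#
    off-ρ σ σ≢ρ = ≈-trans (*-congˡ (W-offdiag σ ρ λ ρ≡σ → σ≢ρ (sym ρ≡σ))) (zeroʳ _)

  W·W≈mulW : ∀ σ τ ρ → (W σ · W τ) ρ ≈ mulW σ τ ρ
  W·W≈mulW σ τ ρ = begin
    sumAll (λ σ' → sumAll (λ τ' → W σ σ' * W τ τ' * mulW σ' τ' ρ))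
      ≈⟨ sumAll-point _ σ off-σ ⟩
    sumAll (λ τ' → W σ σ * W τ τ' * mulW σ τ' ρ)
      ≈⟨ sumAll-point _ τ off-τ ⟩
    W σ σ * W τ τ * mulW σ τ ρ
      ≈⟨ *-congʳ (*-cong (W-diag σ) (W-diag τ)) ⟩
    1# * 1# * mulW σ τ ρ
      ≈⟨ *-congʳ (*-identityˡ 1#) ⟩
    1# * mulW σ τ ρ
      ≈⟨ *-identityˡ _ ⟩
    mulW σ τ ρ ∎
    where
    off-σ : ∀ σ' → ¬ σ' ≡ σ → sumAll (λ τ' → W σ σ' * W τ τ' * mulW σ' τ' ρ) ≈ 0#
    off-σ σ' σ'≢σ = sumAll-≈0 (λ τ' → W σ σ' * W τ τ' * mulW σ' τ' ρ) λ τ' →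
      ≈-trans (*-congʳ (≈-trans (*-congʳ (W-offdiag σ σ' σ'≢σ)) (zeroˡ _))) (zeroˡ _)
    off-τ : ∀ τ' → ¬ τ' ≡ τ → W σ σ * W τ τ' * mulW σ τ' ρ ≈ 0#
    off-τ τ' τ'≢τ =
      ≈-trans (*-congʳ (≈-trans (*-congˡ (W-offdiag τ τ' τ'≢τ)) (zeroʳ _))) (zeroˡ _)

  mulW-augmented : ∀ σ τ ρ → mulW σ τ ρ ≈
    (if isEmptyB (σ ∩ τ) ∧ isEmptyB (Y σ τ) then sgn σ τ • W (σ ∪ τ) else 0C) ρ
  mulW-augmented σ τ ρ with isEmptyB (σ ∩ τ) | isEmptyB (Y σ τ)
  ... | false | _     = ≈-refl
  ... | true  | true  = *-congʳ (*-identityʳ _)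
  ... | true  | false = ≈-trans (*-congʳ (zeroʳ _)) (zeroˡ _)

  module Minimal (minimal : TaylorMinimal J) where

    dW≈0 : ∀ σ ρ → dW σ ρ ≈ 0#
    dW≈0 σ ρ = sumFin-≈0 _ term≈0
      where
      term≈0 : ∀ i → (if lookup σ i
                      then sign ∣ σ ∩ below i ∣ * augMonomial (X σ i) * W (σ ⊖ i) ρ
                      else 0#) ≈ 0#
      term≈0 i with lookup σ i in σi
      ... | false = ≈-refl
      ... | true rewrite Nonempty⇒isEmptyB≡false (minimal σ i (lookup⇒[]= i σ σi)) =
        ≈-trans (*-congʳ (zeroʳ _)) (zeroˡ _)

    D≈0 : ∀ z ρ → D z ρ ≈ 0#
    D≈0 z ρ = sumAll-≈0 _ λ σ → ≈-trans (*-congˡ (dW≈0 σ ρ)) (zeroʳ _)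

    ≈⇒∼ : ∀ z z' → (∀ ρ → z ρ ≈ z' ρ) → z ∼ z'
    ≈⇒∼ z z' z≈z' = 0C , λ ρ → begin
      D 0C ρ        ≈⟨ D≈0 0C ρ ⟩
      0#            ≈⟨ ≈-sym (-‿inverseʳ (z' ρ)) ⟩
      z' ρ - z' ρ   ≈⟨ +-congʳ (≈-sym (z≈z' ρ)) ⟩
      z ρ - z' ρ    ∎

    ∼0⇒≈0 : ∀ z → z ∼ 0C → ∀ ρ → z ρ ≈ 0#
    ∼0⇒≈0 z (w , Dw≈z-0) ρ = begin
      z ρ        ≈⟨ ≈-sym (+-identityʳ _) ⟩
      z ρ + 0#   ≈⟨ +-congˡ (≈-sym -0#≈0#) ⟩
      z ρ - 0#   ≈⟨ ≈-sym (Dw≈z-0 ρ) ⟩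
      D w ρ      ≈⟨ D≈0 w ρ ⟩
      0#         ∎

lemma12 : ∀ {c ℓ} (F : Field c ℓ) {m : ℕ} (K : SimplicialComplex m) {n : ℕ}
    (N : NonFaceEnumeration K n) →
    TaylorMinimal (NonFaceEnumeration.J N) →
    let open Field F
        open TaylorTor F (NonFaceEnumeration.J N)
        J = NonFaceEnumeration.J N
    in
    -- each W_σ defines a class in Tor = H(R_T ⊗ k)
    (∀ σ → IsCocycle (W σ))
    -- the classes W_σ are linearly independent
    × (∀ (a : Subset n → Carrier) → lincomb a ∼ 0C → ∀ σ → a σ ≈ 0#)
    -- the classes W_σ span Tor
    × (∀ z → IsCocycle z → ∃ λ a → z ∼ lincomb a)
    -- multidegree of W_σ
    × (∀ σ → mdeg σ ≡ (ℤ.- (ℤ.+ ∣ σ ∣) , map (λ b → if b then 2 else 0) (⋃J J σ)))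
    -- multiplication
    × (∀ σ τ → (W σ · W τ) ∼
         (if isEmptyB (σ ∩ τ) ∧ isEmptyB (⋃J J σ ∩ ⋃J J τ)
          then sgn σ τ • W (σ ∪ τ)
          else 0C))
lemma12 F K N minimal =
    (λ σ → D≈0 (W σ))
  , (λ a a∼0 σ → ≈-trans (≈-sym (lincomb-coordinate a σ)) (∼0⇒≈0 (lincomb a) a∼0 σ))
  , (λ z _ → z , ≈⇒∼ z (lincomb z) (λ ρ → ≈-sym (lincomb-coordinate z ρ)))
  , (λ σ → refl)
  , (λ σ τ → ≈⇒∼ _ _ λ ρ → ≈-trans (W·W≈mulW σ τ ρ) (mulW-augmented σ τ ρ))
  where
  open Field F using () renaming (sym to ≈-sym; trans to ≈-trans)
  open TaylorTor F (NonFaceEnumeration.J N) using (W; lincomb)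
  open TaylorTorProperties F (NonFaceEnumeration.J N)
  open Minimal minimal
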